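{- Let $r\geq 1$, $n\geq 0$ and $m=n+r$. The set $\mathrm{UPF}_m^r$ of unit interval parking functions of length $m$ whose first $r$ entries are distinct is in bijection with the set $\mathrm{FR}_m^r$ of $r$-Fubini rankings of length $m$.
   Context: Let $[m]=\{1,\dots,m\}$. Unit interval parking: $m$ cars enter in order $1,\dots,m$ a one-way street with spots $1,\dots,m$; with preference list $\alpha=(a_1,\dots,a_m)\in[m]^m$, car $i$ parks in spot $a_i$ if free, otherwise in spot $a_i+1$ if it exists and is free, otherwise it fails. $\alpha$ is a unit interval parking function if all cars park. $\mathrm{UPF}_m^r$ is the set of unit interval parking functions $\alpha$ of length $m$ with $|\{a_1,\dots,a_r\}|=r$. A tuple $\beta\in[m]^m$ is a Fubini ranking if its smallest value is $1$ and for every $x$, if exactly $k>0$ entries equal $x$, the next largest value occurring in $\beta$ (if any) is $x+k$. An $r$-Fubini ranking of length $m=n+r$ is a Fubini ranking $(b_1,\dots,b_m)$ with $|\{b_1,\dots,b_r\}|=r$; $\mathrm{FR}_m^r$ is the set of these. -}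

module Defs where

open import Data.Bool using (Bool; true; false; _∧_; _∨_; not; if_then_else_; T)
open import Data.Nat using (ℕ; zero; suc; _+_; _≤ᵇ_; _<ᵇ_; _≡ᵇ_)
open import Data.List using (List; []; _∷_; take; filter)
open import Data.Maybe using (Maybe; nothing; just)
open import Data.Vec using (Vec; toList)
open import Data.Product using (Σ)
open import Data.Nat.Properties using (_<?_)

-- Tuples in [m]^m are represented as Vec ℕ m with values (1-indexed, as in
-- the paper) checked to lie in {1,…,m}.

allB : {A : Set} → (A → Bool) → List A → Bool
allB p []       = true
allB p (x ∷ xs) = p x ∧ allB p xs

elem : ℕ → List ℕ → Bool
elem x []       = false
elem x (y ∷ ys) = (x ≡ᵇ y) ∨ elem x ys

inRange : ℕ → List ℕ → Bool
inRange m = allB (λ a → (1 ≤ᵇ a) ∧ (a ≤ᵇ m))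

distinct : List ℕ → Bool
distinct []       = true
distinct (x ∷ xs) = not (elem x xs) ∧ distinct xs

-- Unit interval parking process on spots 1..m.  'occ' is the list of
-- occupied spots; the cars (preferences) arrive in order.
parks : ℕ → List ℕ → List ℕ → Bool
parks m occ []       = true
parks m occ (a ∷ as) =
  if not (elem a occ) then parks m (a ∷ occ) as
  else if ((suc a) ≤ᵇ m) ∧ not (elem (suc a) occ) then parks m (suc a ∷ occ) as
  else false

isUPF : (m : ℕ) → Vec ℕ m → Bool
isUPF m α = inRange m (toList α) ∧ parks m [] (toList α)

isUPFr : (m r : ℕ) → Vec ℕ m → Bool
isUPFr m r α = isUPF m α ∧ distinct (take r (toList α))

count : ℕ → List ℕ → ℕ
count x []       = 0
count x (y ∷ ys) = if x ≡ᵇ y then suc (count x ys) else count x ys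

minimum : List ℕ → Maybe ℕ
minimum []       = nothing
minimum (x ∷ xs) with minimum xs
... | nothing = just x
... | just y  = just (if x ≤ᵇ y then x else y)

nextLarger : ℕ → List ℕ → Maybe ℕ
nextLarger x β = minimum (filter (λ y → x <? y) β)

maybeEq : Maybe ℕ → ℕ → Bool
maybeEq nothing  _ = true
maybeEq (just y) z = y ≡ᵇ z

isFubiniList : List ℕ → Bool
isFubiniList β =
  (minimum β ≡ᴹ 1) ∧ allB (λ x → maybeEq (nextLarger x β) (x + count x β)) β
  where
  _≡ᴹ_ : Maybe ℕ → ℕ → Bool
  nothing ≡ᴹ _ = false
  just y  ≡ᴹ z = y ≡ᵇ z

isFR : (m : ℕ) → Vec ℕ m → Bool
isFR m β = inRange m (toList β) ∧ isFubiniList (toList β)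

isFRr : (m r : ℕ) → Vec ℕ m → Bool
isFRr m r β = isFR m β ∧ distinct (take r (toList β))

-- the sets UPF_m^r and FR_m^r as subtypes (T of a Bool is proof-irrelevant,
-- so propositional equality on these subtypes is equality of tuples)
UPF : (m r : ℕ) → Set
UPF m r = Σ (Vec ℕ m) (λ α → T (isUPFr m r α))

FR : (m r : ℕ) → Set
FR m r = Σ (Vec ℕ m) (λ β → T (isFRr m r β))

{-# OPTIONS --safe #-}

-- A Fubini ranking is a ranking with ties: each entry x is one more than the number of
-- entries smaller than x.  Read it as a multiset in which x owns the block of spots
-- [x, x + #x), #x the multiplicity of x.  A list of length m is a Fubini ranking iff these
-- blocks are pairwise disjoint and lie inside [1, m]; by counting, they then tile [1, m].
--
-- Let the (c+1)-th car of rank b prefer b + (c − 1), or b when c = 0.  Inductively the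
-- occupied spots are exactly the blocks of the ranks seen so far, so this car either finds
-- its preference b free (c = 0) or finds it occupied and the next spot b + c free: it parks
-- at b + c, extending its block.  Conversely, in a unit interval parking function a car
-- that parks at its preference a opens a new block of rank a, and a car bumped from a to
-- a + 1 extends the block ending at a; this recovers the ranks and inverts the first map.
-- Both maps fix first occurrences, so distinctness of the first r entries is preserved.

module Submission where

open import Defs
open import Data.Bool using (Bool; true; false; not; T; if_then_else_)
open import Data.Bool.Properties using (T-≡; T-∧; T-∨; T-not-≡; T-irrelevant)
open import Data.List using (List; []; _∷_; [_]; _++_; filter; length; take)
open import Data.List.Membership.Propositional using (_∈_; find; lose)
open import Data.List.Membership.Propositional.Properties using (∈-filter⁺; ∈-filter⁻)
open import Data.List.Properties
  using (length-filter; filter-all; filter-none; filter-accept; filter-reject; ++-identityʳ)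
open import Data.List.Relation.Unary.All as All using ()
open import Data.List.Relation.Unary.Any using (here; there; any?)
open import Data.Maybe using (just; nothing)
open import Data.Nat
open import Data.Nat.Properties
open import Data.Nat.Tactic.RingSolver using (solve-∀)
open import Data.Product using (Σ; ∃; _×_; _,_; proj₁; proj₂)
open import Data.Sum using (_⊎_; inj₁; inj₂; map₁; map₂)
open import Data.Vec using (Vec; toList) renaming ([] to []ᵥ; _∷_ to _∷ᵥ_)
open import Data.Vec.Properties using (length-toList)
open import Function using (_∘_; _⇔_; mk⇔; Equivalence; case_of_)
open import Function.Bundles using (_⤖_; mk↔ₛ′)
open import Function.Properties.Inverse using (↔⇒⤖)
open import Relation.Binary.Definitions using (tri<; tri≈; tri>)
open import Relation.Binary.PropositionalEquality hiding ([_])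
open import Relation.Nullary using (¬_; yes; no; contradiction)

open Equivalence using (to; from)

n≡0⊎n>0 : ∀ n → n ≡ 0 ⊎ 0 < n
n≡0⊎n>0 zero    = inj₁ refl
n≡0⊎n>0 (suc n) = inj₂ z<s

¬T⇒≡false : ∀ {b} → ¬ T b → b ≡ false
¬T⇒≡false {false} _  = refl
¬T⇒≡false {true}  ¬t = contradiction _ ¬t

count-∷-≡ : ∀ x L → count x (x ∷ L) ≡ suc (count x L)
count-∷-≡ x L rewrite to T-≡ (≡⇒≡ᵇ x x refl) = refl

count-∷-≢ : ∀ {x y} L → x ≢ y → count x (y ∷ L) ≡ count x L
count-∷-≢ {x} {y} L x≢y rewrite ¬T⇒≡false (x≢y ∘ ≡ᵇ⇒≡ x y) = refl

count-++ : ∀ x K L → count x (K ++ L) ≡ count x K + count x L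
count-++ x []      L = refl
count-++ x (y ∷ K) L with x ≟ y
... | yes refl rewrite count-∷-≡ x (K ++ L) | count-∷-≡ x K = cong suc (count-++ x K L)
... | no  x≢y  rewrite count-∷-≢ (K ++ L) x≢y | count-∷-≢ K x≢y = count-++ x K L

∈⇒count>0 : ∀ {x L} → x ∈ L → 0 < count x L
∈⇒count>0 {x} {y ∷ L} (here refl) rewrite count-∷-≡ x L = z<s
∈⇒count>0 {x} {y ∷ L} (there x∈L) with x ≟ y
... | yes refl rewrite count-∷-≡ x L = z<s
... | no  x≢y  rewrite count-∷-≢ L x≢y = ∈⇒count>0 x∈L

count>0⇒∈ : ∀ {x L} → 0 < count x L → x ∈ L
count>0⇒∈ {x} {y ∷ L} x>0 with x ≟ y
... | yes refl = here refl
... | no  x≢y  rewrite count-∷-≢ L x≢y = there (count>0⇒∈ x>0)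

elem-∷ : ∀ {s t l} → T (elem s (t ∷ l)) ⇔ (s ≡ t ⊎ T (elem s l))
elem-∷ {s} {t} = mk⇔ (map₁ (≡ᵇ⇒≡ s t) ∘ to T-∨) (from T-∨ ∘ map₁ (≡⇒≡ᵇ s t))

∈⇒elem : ∀ {s l} → s ∈ l → T (elem s l)
∈⇒elem {l = _ ∷ l} (here refl)  = from (elem-∷ {l = l}) (inj₁ refl)
∈⇒elem {l = _ ∷ l} (there s∈l) = from (elem-∷ {l = l}) (inj₂ (∈⇒elem s∈l))

distinct-∷⁻ : ∀ {b l} → T (distinct (b ∷ l)) → ¬ T (elem b l) × T (distinct l)
distinct-∷⁻ {b} {l} d =
  let b∉l , rest = to (T-∧ {not (elem b l)}) d in subst T (to T-not-≡ b∉l) , rest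

allB⇔ : ∀ {A : Set} {p : A → Bool} {L} → T (allB p L) ⇔ (∀ {x} → x ∈ L → T (p x))
allB⇔ {p = p} {L} = mk⇔ (elim L) (intro L)
  where
  elim : ∀ L → T (allB p L) → ∀ {x} → x ∈ L → T (p x)
  elim (y ∷ L) t (here refl)  = proj₁ (to T-∧ t)
  elim (y ∷ L) t (there x∈L) = elim L (proj₂ (to T-∧ t)) x∈L
  intro : ∀ L → (∀ {x} → x ∈ L → T (p x)) → T (allB p L)
  intro []      h = _
  intro (y ∷ L) h = from T-∧ (h (here refl) , intro L (h ∘ there))

inRange⇔ : ∀ {m L} → T (inRange m L) ⇔ (∀ {x} → x ∈ L → 1 ≤ x × x ≤ m)
inRange⇔ {m} = mk⇔
  (λ t {x} x∈L → let 1≤x , x≤m = to T-∧ (to allB⇔ t x∈L) in ≤ᵇ⇒≤ 1 x 1≤x , ≤ᵇ⇒≤ x m x≤m)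
  (λ h → from allB⇔ λ {x} x∈L → let 1≤x , x≤m = h x∈L in from T-∧ (≤⇒≤ᵇ 1≤x , ≤⇒≤ᵇ x≤m))

minimum-∷ : ∀ x xs → ∃ λ z → minimum (x ∷ xs) ≡ just z
minimum-∷ x xs with minimum xs
... | nothing = x , refl
... | just y  = _ , refl

minimum-nothing : ∀ {L} → minimum L ≡ nothing → L ≡ []
minimum-nothing {[]}     _  = refl
minimum-nothing {x ∷ xs} eq with minimum xs
minimum-nothing {x ∷ xs} () | nothing
minimum-nothing {x ∷ xs} () | just _

minimum-just : ∀ {L z} → minimum L ≡ just z → z ∈ L × (∀ {y} → y ∈ L → z ≤ y)
minimum-just {x ∷ xs} eq with minimum xs in eq′
... | nothing with refl ← eq | refl ← minimum-nothing {xs} eq′ = here refl , λ { (here refl) → ≤-refl }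
... | just y  with refl ← eq = smaller (minimum-just eq′)
  where
  smaller : y ∈ xs × (∀ {w} → w ∈ xs → y ≤ w) →
            (if x ≤ᵇ y then x else y) ∈ x ∷ xs × (∀ {w} → w ∈ x ∷ xs → (if x ≤ᵇ y then x else y) ≤ w)
  smaller (y∈xs , y≤) with x ≤ᵇ y in x≤ᵇy
  ... | true  = here refl ,
                λ { (here refl) → ≤-refl ; (there w∈xs) → ≤-trans (≤ᵇ⇒≤ x y (from T-≡ x≤ᵇy)) (y≤ w∈xs) }
  ... | false = there y∈xs ,
                λ { (here refl) → <⇒≤ (≰⇒> (subst T x≤ᵇy ∘ ≤⇒≤ᵇ)) ; (there w∈xs) → y≤ w∈xs }

nextLarger-just : ∀ {x L z} → nextLarger x L ≡ just z →
                  z ∈ L × x < z × (∀ {y} → y ∈ L → x < y → z ≤ y)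
nextLarger-just {x} {L} eq =
  let z∈ , z≤ = minimum-just eq
      z∈L , x<z = ∈-filter⁻ (x <?_) {xs = L} z∈
  in z∈L , x<z , λ y∈L x<y → z≤ (∈-filter⁺ (x <?_) y∈L x<y)

nextLarger-nothing : ∀ {x L y} → nextLarger x L ≡ nothing → y ∈ L → y ≤ x
nextLarger-nothing {x} {L} eq y∈L = ≮⇒≥ λ x<y →
  case subst (_ ∈_) (minimum-nothing eq) (∈-filter⁺ (x <?_) y∈L x<y) of λ ()

isFubiniList⇔ : ∀ {L} → T (isFubiniList L) ⇔
                (minimum L ≡ just 1 × T (allB (λ x → maybeEq (nextLarger x L) (x + count x L)) L))
isFubiniList⇔ {L} with minimum L
... | nothing = mk⇔ (λ ()) (λ { (() , _) })
... | just y  = mk⇔ (λ t → let y≡ᵇ1 , rest = to T-∧ t in cong just (≡ᵇ⇒≡ y 1 y≡ᵇ1) , rest)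
                    (λ { (refl , rest) → from T-∧ (_ , rest) })

-- Counting entries below a bound

countBelow : ℕ → List ℕ → ℕ
countBelow u L = length (filter (_<? u) L)

countBelow-∷-< : ∀ {u y} L → y < u → countBelow u (y ∷ L) ≡ suc (countBelow u L)
countBelow-∷-< {u} L y<u = cong length (filter-accept (_<? u) y<u)

countBelow-∷-≥ : ∀ {u y} L → u ≤ y → countBelow u (y ∷ L) ≡ countBelow u L
countBelow-∷-≥ {u} L u≤y = cong length (filter-reject (_<? u) (≤⇒≯ u≤y))

countBelow-suc : ∀ x L → countBelow (suc x) L ≡ countBelow x L + count x L
countBelow-suc x []      = refl
countBelow-suc x (y ∷ L) with <-cmp y x
... | tri< y<x y≢x _ rewrite countBelow-∷-< L (m<n⇒m<1+n y<x) | countBelow-∷-< L y<x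
                           | count-∷-≢ L (y≢x ∘ sym) = cong suc (countBelow-suc x L)
... | tri≈ _ refl _ rewrite countBelow-∷-< L (n<1+n y) | countBelow-∷-≥ L (≤-refl {y})
                          | count-∷-≡ y L = trans (cong suc (countBelow-suc y L)) (sym (+-suc _ _))
... | tri> _ y≢x x<y rewrite countBelow-∷-≥ L x<y | countBelow-∷-≥ L (<⇒≤ x<y)
                           | count-∷-≢ L (y≢x ∘ sym) = countBelow-suc x L

countBelow-mono : ∀ {x y} L → x ≤ y → countBelow x L ≤ countBelow y L
countBelow-mono []      x≤y = z≤n
countBelow-mono {x} {y} (z ∷ L) x≤y with z <? x | z <? y
... | yes z<x | yes z<y rewrite countBelow-∷-< L z<x | countBelow-∷-< L z<y =
  s≤s (countBelow-mono L x≤y)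
... | yes z<x | no  z≮y = contradiction (<-≤-trans z<x x≤y) z≮y
... | no  z≮x | yes z<y rewrite countBelow-∷-≥ L (≮⇒≥ z≮x) | countBelow-∷-< L z<y =
  m≤n⇒m≤1+n (countBelow-mono L x≤y)
... | no  z≮x | no  z≮y rewrite countBelow-∷-≥ L (≮⇒≥ z≮x) | countBelow-∷-≥ L (≮⇒≥ z≮y) =
  countBelow-mono L x≤y

countBelow-gap : ∀ {x y L} → x ≤ y → (∀ {z} → z ∈ L → x ≤ z → y ≤ z) → countBelow x L ≡ countBelow y L
countBelow-gap {L = []}    x≤y gap = refl
countBelow-gap {x} {y} {z ∷ L} x≤y gap with z <? x
... | yes z<x rewrite countBelow-∷-< L z<x | countBelow-∷-< L (<-≤-trans z<x x≤y) =
  cong suc (countBelow-gap x≤y (gap ∘ there))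
... | no  z≮x rewrite countBelow-∷-≥ L (≮⇒≥ z≮x) | countBelow-∷-≥ L (gap (here refl) (≮⇒≥ z≮x)) =
  countBelow-gap x≤y (gap ∘ there)

countBelow-none : ∀ {u L} → (∀ {z} → z ∈ L → u ≤ z) → countBelow u L ≡ 0
countBelow-none {u} u≤ = cong length (filter-none (_<? u) (All.tabulate (≤⇒≯ ∘ u≤)))

countBelow-all : ∀ {u L} → (∀ {z} → z ∈ L → z < u) → countBelow u L ≡ length L
countBelow-all {u} <u = cong length (filter-all (_<? u) (All.tabulate <u))

countBelow-nextLarger : ∀ {x L z} → nextLarger x L ≡ just z → countBelow z L ≡ countBelow (suc x) L
countBelow-nextLarger {x} {L} eq =
  let _ , x<z , z≤ = nextLarger-just {x} {L} eq in sym (countBelow-gap {L = L} x<z z≤)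

-- Rankings and blocks

Ranking : List ℕ → Set
Ranking L = ∀ {x} → x ∈ L → x ≡ suc (countBelow x L)

Separated : List ℕ → Set
Separated L = ∀ {x y} → x < y → 0 < count y L → x + count x L ≤ y

Bounded : ℕ → List ℕ → Set
Bounded m L = ∀ {x} → 0 < count x L → 1 ≤ x × x + count x L ≤ suc m

Bounded-entry : ∀ {m L z} → Bounded m L → z ∈ L → 1 ≤ z × z ≤ m
Bounded-entry {m} {L} {z} bound z∈L = proj₁ (bound z>0) , s≤s⁻¹ (begin
  suc z           ≡⟨ +-comm 1 z ⟩
  z + 1           ≤⟨ +-monoʳ-≤ z z>0 ⟩
  z + count z L   ≤⟨ proj₂ (bound z>0) ⟩
  suc m           ∎)
  where
  open ≤-Reasoning
  z>0 = ∈⇒count>0 z∈L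

ranked-blockEnd : ∀ {L x} → x ≡ suc (countBelow x L) → x + count x L ≡ suc (countBelow (suc x) L)
ranked-blockEnd {L} {x} x-ranked = begin
  x + count x L                      ≡⟨ cong (_+ count x L) x-ranked ⟩
  suc (countBelow x L + count x L)   ≡⟨ cong suc (countBelow-suc x L) ⟨
  suc (countBelow (suc x) L)         ∎
  where open ≡-Reasoning

Ranking⇒Separated : ∀ {L} → Ranking L → Separated L
Ranking⇒Separated {L} rank {x} {y} x<y y>0 with n≡0⊎n>0 (count x L)
... | inj₁ x≡0 rewrite x≡0 | +-identityʳ x = <⇒≤ x<y
... | inj₂ x>0 = begin
  x + count x L                ≡⟨ ranked-blockEnd {L} (rank (count>0⇒∈ x>0)) ⟩
  suc (countBelow (suc x) L)   ≤⟨ s≤s (countBelow-mono L x<y) ⟩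
  suc (countBelow y L)         ≡⟨ rank (count>0⇒∈ y>0) ⟨
  y                            ∎
  where open ≤-Reasoning

Ranking⇒Bounded : ∀ {L} → Ranking L → Bounded (length L) L
Ranking⇒Bounded {L} rank {x} x>0 =
  subst (1 ≤_) (sym x-ranked) (s≤s z≤n) ,
  subst (_≤ suc (length L)) (sym (ranked-blockEnd {L} x-ranked)) (s≤s (length-filter _ L))
  where
  x-ranked = rank (count>0⇒∈ x>0)

-- [lo, u) contains at most u − lo entries of L, stated without subtraction.
Sparse : List ℕ → ℕ → ℕ → Set
Sparse L lo u = countBelow u L + lo ≤ countBelow lo L + u

Sparse-trans : ∀ {L lo mid u} → Sparse L lo mid → Sparse L mid u → Sparse L lo u
Sparse-trans {L} {lo} {mid} {u} p q = +-cancelʳ-≤ (countBelow mid L + mid) _ _ (begin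
  (countBelow u L + lo) + (countBelow mid L + mid)   ≡⟨ shuffle (countBelow u L) lo (countBelow mid L) mid ⟩
  (countBelow u L + mid) + (countBelow mid L + lo)   ≤⟨ +-mono-≤ q p ⟩
  (countBelow mid L + u) + (countBelow lo L + mid)   ≡⟨ swap (countBelow mid L) u (countBelow lo L) mid ⟩
  (countBelow lo L + u) + (countBelow mid L + mid)   ∎)
  where
  open ≤-Reasoning
  shuffle : ∀ a b c d → (a + b) + (c + d) ≡ (a + d) + (c + b)
  shuffle = solve-∀
  swap : ∀ a b c d → (a + b) + (c + d) ≡ (c + b) + (a + d)
  swap = solve-∀

Sparse-step : ∀ {L lo u} → Separated L → lo < u → (0 < count lo L → lo + count lo L ≤ u) →
              ∃ λ lo′ → lo < lo′ × lo′ ≤ u × Sparse L lo lo′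
Sparse-step {L} {lo} sep lo<u fits with count lo L in c≡ | countBelow-suc lo L
... | zero  | below≡ = suc lo , ≤-refl , lo<u , (begin
  countBelow (suc lo) L + lo   ≡⟨ cong (_+ lo) (trans below≡ (+-identityʳ _)) ⟩
  countBelow lo L + lo         ≤⟨ +-monoʳ-≤ _ (n≤1+n lo) ⟩
  countBelow lo L + suc lo     ∎)
  where open ≤-Reasoning
... | suc c | below≡ = lo + suc c , m<m+n lo z<s , fits z<s , ≤-reflexive (begin
  countBelow (lo + suc c) L + lo   ≡⟨ cong (_+ lo) (countBelow-gap (m<m+n lo z<s) after-block) ⟨
  countBelow (suc lo) L + lo       ≡⟨ cong (_+ lo) below≡ ⟩
  (countBelow lo L + suc c) + lo   ≡⟨ +-assoc (countBelow lo L) (suc c) lo ⟩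
  countBelow lo L + (suc c + lo)   ≡⟨ cong (countBelow lo L +_) (+-comm (suc c) lo) ⟩
  countBelow lo L + (lo + suc c)   ∎)
  where
  open ≡-Reasoning
  after-block : ∀ {z} → z ∈ L → suc lo ≤ z → lo + suc c ≤ z
  after-block z∈L lo<z = subst (λ c′ → lo + c′ ≤ _) c≡ (sep lo<z (∈⇒count>0 z∈L))

Separated⇒Sparse : ∀ {L lo u} → Separated L → lo ≤ u →
                   (∀ {y} → lo ≤ y → y < u → 0 < count y L → y + count y L ≤ u) → Sparse L lo u
Separated⇒Sparse {L} {lo} {u} sep lo≤u = go u lo≤u (m≤n+m u lo)
  where
  go : ∀ k {lo} → lo ≤ u → u ≤ lo + k →
       (∀ {y} → lo ≤ y → y < u → 0 < count y L → y + count y L ≤ u) → Sparse L lo u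
  go k {lo} lo≤u u≤lo+k fits with m≤n⇒m<n∨m≡n lo≤u
  ... | inj₂ refl = ≤-refl
  go zero    {lo} lo≤u u≤lo+k fits | inj₁ lo<u =
    contradiction (subst (_ ≤_) (+-identityʳ lo) u≤lo+k) (<⇒≱ lo<u)
  go (suc k) {lo} lo≤u u≤lo+k fits | inj₁ lo<u =
    let lo′ , lo<lo′ , lo′≤u , sparse = Sparse-step {L} sep lo<u (fits ≤-refl lo<u)
        u≤lo′+k = ≤-trans u≤lo+k (≤-trans (≤-reflexive (+-suc lo k)) (+-monoˡ-≤ k lo<lo′))
    in Sparse-trans {L} sparse (go k lo′≤u u≤lo′+k (fits ∘ ≤-trans (<⇒≤ lo<lo′)))

Separated×Bounded⇒Ranking : ∀ {L} → Separated L → Bounded (length L) L → Ranking L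
Separated×Bounded⇒Ranking {L} sep bound {x} x∈L = ≤-antisym upper lower
  where
  m = length L
  x>0 = ∈⇒count>0 x∈L
  below : Sparse L 1 x
  below = Separated⇒Sparse {L} sep (proj₁ (bound x>0)) (λ _ y<x _ → sep y<x x>0)
  above : Sparse L x (suc m)
  above = Separated⇒Sparse {L} sep (m≤n⇒m≤1+n (proj₂ (Bounded-entry bound x∈L)))
                             (λ _ _ y>0 → proj₂ (bound y>0))
  lower : suc (countBelow x L) ≤ x
  lower = begin
    suc (countBelow x L)   ≡⟨ +-comm 1 _ ⟩
    countBelow x L + 1     ≤⟨ below ⟩
    countBelow 1 L + x     ≡⟨ cong (_+ x) (countBelow-none {L = L} (proj₁ ∘ Bounded-entry bound)) ⟩
    x                      ∎
    where open ≤-Reasoning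
  upper : x ≤ suc (countBelow x L)
  upper = +-cancelˡ-≤ m x _ (begin
    m + x                      ≡⟨ cong (_+ x) (countBelow-all {L = L} (s≤s ∘ proj₂ ∘ Bounded-entry bound)) ⟨
    countBelow (suc m) L + x   ≤⟨ above ⟩
    countBelow x L + suc m     ≡⟨ +-comm _ (suc m) ⟩
    suc m + countBelow x L     ≡⟨ +-suc m _ ⟨
    m + suc (countBelow x L)   ∎)
    where open ≤-Reasoning

Ranking⇒isFubiniList : ∀ {x xs} → Ranking (x ∷ xs) → T (isFubiniList (x ∷ xs))
Ranking⇒isFubiniList {x} {xs} rank = from isFubiniList⇔ (minimum≡1 , from allB⇔ nextLarger≡)
  where
  L = x ∷ xs
  minimum≡1 : minimum L ≡ just 1
  minimum≡1 =
    let z , eq = minimum-∷ x xs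
        z∈L , z≤ = minimum-just eq
    in trans eq (cong just (trans (rank z∈L) (cong suc (countBelow-none {L = L} z≤))))
  nextLarger≡ : ∀ {y} → y ∈ L → T (maybeEq (nextLarger y L) (y + count y L))
  nextLarger≡ {y} y∈L with nextLarger y L in eq
  ... | nothing = _
  ... | just z  = ≡⇒≡ᵇ z _ (begin
    z                            ≡⟨ rank (proj₁ (nextLarger-just {y} {L} eq)) ⟩
    suc (countBelow z L)         ≡⟨ cong suc (countBelow-nextLarger {y} {L} eq) ⟩
    suc (countBelow (suc y) L)   ≡⟨ ranked-blockEnd {L} (rank y∈L) ⟨
    y + count y L                ∎)
    where open ≡-Reasoning

isFubiniList⇒Ranking : ∀ {L} → T (isFubiniList L) → Ranking L
isFubiniList⇒Ranking {L} t {y} y∈L = climb y 1∈L 1-ranked y∈L (1≤ y∈L) (n≤1+n y)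
  where
  nextLarger≡ : ∀ {y} → y ∈ L → T (maybeEq (nextLarger y L) (y + count y L))
  nextLarger≡ = to allB⇔ (proj₂ (to (isFubiniList⇔ {L}) t))
  1∈L : 1 ∈ L
  1∈L = proj₁ (minimum-just (proj₁ (to (isFubiniList⇔ {L}) t)))
  1≤ : ∀ {z} → z ∈ L → 1 ≤ z
  1≤ = proj₂ (minimum-just (proj₁ (to (isFubiniList⇔ {L}) t)))
  1-ranked : 1 ≡ suc (countBelow 1 L)
  1-ranked = cong suc (sym (countBelow-none {L = L} 1≤))
  climb : ∀ k {v y} → v ∈ L → v ≡ suc (countBelow v L) → y ∈ L → v ≤ y → y ≤ v + k →
          y ≡ suc (countBelow y L)
  climb k {v} {y} v∈L v-ranked y∈L v≤y y≤v+k with v ≟ y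
  ... | yes refl = v-ranked
  ... | no  v≢y with nextLarger v L in eq | nextLarger≡ v∈L | k
  ...   | nothing | _  | _     = contradiction (nextLarger-nothing {v} {L} eq y∈L) (<⇒≱ (≤∧≢⇒< v≤y v≢y))
  ...   | just z  | _  | zero  = contradiction (≤-antisym v≤y (subst (y ≤_) (+-identityʳ v) y≤v+k)) v≢y
  ...   | just z  | z≡ | suc k = climb k z∈L z-ranked y∈L (z≤ y∈L (≤∧≢⇒< v≤y v≢y))
                                   (≤-trans y≤v+k (≤-trans (≤-reflexive (+-suc v k)) (+-monoˡ-≤ k v<z)))
    where
    z∈L = proj₁ (nextLarger-just {v} {L} eq)
    v<z = proj₁ (proj₂ (nextLarger-just {v} {L} eq))
    z≤ = proj₂ (proj₂ (nextLarger-just {v} {L} eq))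
    z-ranked : z ≡ suc (countBelow z L)
    z-ranked = begin
      z                            ≡⟨ ≡ᵇ⇒≡ z (v + count v L) z≡ ⟩
      v + count v L                ≡⟨ ranked-blockEnd {L} v-ranked ⟩
      suc (countBelow (suc v) L)   ≡⟨ cong suc (countBelow-nextLarger {v} {L} eq) ⟨
      suc (countBelow z L)         ∎
      where open ≡-Reasoning

-- Parking into blocks

record _⊑_ (K L : List ℕ) : Set where
  constructor count-≤
  field count-mono : ∀ x → count x K ≤ count x L

open _⊑_

Separated-⊑ : ∀ {K L} → K ⊑ L → Separated L → Separated K
Separated-⊑ K⊑L sep {x} x<y y>0 =
  ≤-trans (+-monoʳ-≤ x (count-mono K⊑L x)) (sep x<y (<-≤-trans y>0 (count-mono K⊑L _)))

Bounded-⊑ : ∀ {m K L} → K ⊑ L → Bounded m L → Bounded m K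
Bounded-⊑ K⊑L bound {x} x>0 =
  let 1≤x , end≤ = bound (<-≤-trans x>0 (count-mono K⊑L x))
  in 1≤x , ≤-trans (+-monoʳ-≤ x (count-mono K⊑L x)) end≤

⊑-++ : ∀ K L → K ⊑ (K ++ L)
⊑-++ K L = count-≤ λ x → subst (count x K ≤_) (sym (count-++ x K L)) (m≤m+n _ _)

⊑-∷ : ∀ b K → K ⊑ (b ∷ K)
⊑-∷ b K = count-≤ λ x → subst (count x K ≤_) (sym (count-++ x [ b ] K)) (m≤n+m _ _)

count-shift : ∀ x K b L → count x (K ++ b ∷ L) ≡ count x (b ∷ K ++ L)
count-shift x K b L = begin
  count x (K ++ [ b ] ++ L)                 ≡⟨ count-++ x K ([ b ] ++ L) ⟩
  count x K + count x ([ b ] ++ L)          ≡⟨ cong (count x K +_) (count-++ x [ b ] L) ⟩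
  count x K + (count x [ b ] + count x L)   ≡⟨ exchange (count x K) (count x [ b ]) (count x L) ⟩
  count x [ b ] + (count x K + count x L)   ≡⟨ cong (count x [ b ] +_) (count-++ x K L) ⟨
  count x [ b ] + count x (K ++ L)          ≡⟨ count-++ x [ b ] (K ++ L) ⟨
  count x ([ b ] ++ K ++ L)                 ∎
  where
  open ≡-Reasoning
  exchange : ∀ a b c → a + (b + c) ≡ b + (a + c)
  exchange = solve-∀

shift-⊑ : ∀ K b L → (K ++ b ∷ L) ⊑ (b ∷ K ++ L)
shift-⊑ K b L = count-≤ λ x → ≤-reflexive (count-shift x K b L)

unshift-⊑ : ∀ K b L → (b ∷ K ++ L) ⊑ (K ++ b ∷ L)
unshift-⊑ K b L = count-≤ λ x → ≤-reflexive (sym (count-shift x K b L))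

∷-⊑-shift : ∀ K b L → (b ∷ K) ⊑ (K ++ b ∷ L)
∷-⊑-shift K b L = count-≤ λ x → ≤-trans (count-mono (⊑-++ (b ∷ K) L) x) (count-mono (unshift-⊑ K b L) x)


InBlock : List ℕ → ℕ → ℕ → Set
InBlock acc x s = x ≤ s × s < x + count x acc

Covered : List ℕ → ℕ → Set
Covered acc s = ∃ λ x → InBlock acc x s

preference : List ℕ → ℕ → ℕ
preference acc b = b + pred (count b acc)

Covered-[] : ∀ {s} → ¬ Covered [] s
Covered-[] (x , x≤s , s<x) = <⇒≱ s<x (subst (_≤ _) (sym (+-identityʳ x)) x≤s)

InBlock-self : ∀ {acc x} → 0 < count x acc → InBlock acc x x
InBlock-self {x = x} x>0 = ≤-refl , m<m+n x x>0

InBlock-preference : ∀ {acc x} → 0 < count x acc → InBlock acc x (preference acc x)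
InBlock-preference {acc} {x} x>0 with count x acc
... | suc c = m≤m+n x c , +-monoʳ-< x ≤-refl

InBlock⇒count>0 : ∀ {acc x s} → InBlock acc x s → 0 < count x acc
InBlock⇒count>0 {acc} {x} (x≤s , s<x+c) with count x acc
... | zero  = contradiction (subst (_ <_) (+-identityʳ x) s<x+c) (≤⇒≯ x≤s)
... | suc c = z<s

InBlock-unique : ∀ {acc x y s} → Separated acc → InBlock acc x s → InBlock acc y s → x ≡ y
InBlock-unique {acc} {x} {y} sep x-block@(x≤s , s<x+c) y-block@(y≤s , s<y+c) with <-cmp x y
... | tri< x<y _ _ = contradiction (≤-trans (sep x<y (InBlock⇒count>0 {acc} y-block)) y≤s) (<⇒≱ s<x+c)
... | tri≈ _ x≡y _ = x≡y
... | tri> _ _ y<x = contradiction (≤-trans (sep y<x (InBlock⇒count>0 {acc} x-block)) x≤s) (<⇒≱ s<y+c)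

uncovered⇒count≡0 : ∀ {acc x} → ¬ Covered acc x → count x acc ≡ 0
uncovered⇒count≡0 {acc} {x} x-free with n≡0⊎n>0 (count x acc)
... | inj₁ x≡0 = x≡0
... | inj₂ x>0 = contradiction (x , InBlock-self {acc} x>0) x-free

uncovered-blockEnd : ∀ {acc x s} → ¬ Covered acc s → x ≤ s → x + count x acc ≤ s
uncovered-blockEnd {x = x} s-free x≤s = ≮⇒≥ λ s<end → s-free (x , x≤s , s<end)

absent-blockEnd : ∀ {acc b} → count b acc ≡ 0 → b + count b acc ≡ b
absent-blockEnd {b = b} b≡0 = trans (cong (b +_) b≡0) (+-identityʳ b)

absent-preference : ∀ {acc b} → count b acc ≡ 0 → preference acc b ≡ b
absent-preference {b = b} b≡0 = trans (cong (λ c → b + pred c) b≡0) (+-identityʳ b)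

preference-blockEnd : ∀ {acc x} → 0 < count x acc → x + count x acc ≡ suc (preference acc x)
preference-blockEnd {acc} {x} x>0 with count x acc
... | suc c = +-suc x c

preference≤blockEnd : ∀ {acc b} → preference acc b ≤ b + count b acc
preference≤blockEnd {acc} {b} = +-monoʳ-≤ b (pred[n]≤n {count b acc})

Covered-∷ : ∀ {acc b s} → Covered (b ∷ acc) s ⇔ (s ≡ b + count b acc ⊎ Covered acc s)
Covered-∷ {acc} {b} {s} = mk⇔ split join
  where
  split : Covered (b ∷ acc) s → s ≡ b + count b acc ⊎ Covered acc s
  split (x , x≤s , s<x+c) with x ≟ b
  ... | no  x≢b rewrite count-∷-≢ acc x≢b = inj₂ (x , x≤s , s<x+c)
  ... | yes refl rewrite count-∷-≡ x acc with m≤n⇒m<n∨m≡n (s≤s⁻¹ (subst (s <_) (+-suc x _) s<x+c))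
  ...   | inj₁ s<end = inj₂ (x , x≤s , s<end)
  ...   | inj₂ s≡end = inj₁ s≡end
  join : s ≡ b + count b acc ⊎ Covered acc s → Covered (b ∷ acc) s
  join (inj₁ refl) =
    b , m≤m+n b _ , subst (λ c → b + count b acc < b + c) (sym (count-∷-≡ b acc)) (+-monoʳ-< b ≤-refl)
  join (inj₂ (x , x≤s , s<x+c)) = x , x≤s , <-≤-trans s<x+c (+-monoʳ-≤ x (count-mono (⊑-∷ b acc) x))

Separated-∷ : ∀ {acc b} → Separated acc → ¬ Covered acc (b + count b acc) → Separated (b ∷ acc)
Separated-∷ {acc} {b} sep free {x} {y} x<y y>0 with x ≟ b | y ≟ b
... | yes refl | yes refl = contradiction x<y (<-irrefl refl)
... | yes refl | no  y≢b rewrite count-∷-≡ x acc | count-∷-≢ acc y≢b =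
  subst (_≤ y) (sym (+-suc x _))
        (≤∧≢⇒< (sep x<y y>0) λ end≡y → free (subst (Covered acc) (sym end≡y) (y , InBlock-self {acc} y>0)))
... | no  x≢b | no  y≢b rewrite count-∷-≢ acc x≢b | count-∷-≢ acc y≢b = sep x<y y>0
... | no  x≢b | yes refl rewrite count-∷-≢ acc x≢b with n≡0⊎n>0 (count y acc)
...   | inj₂ y>0′ = sep x<y y>0′
...   | inj₁ y≡0  =
  uncovered-blockEnd {acc} (subst (¬_ ∘ Covered acc) (absent-blockEnd {acc} y≡0) free) (<⇒≤ x<y)

Separated-∷⇒uncovered : ∀ {acc b} → Separated (b ∷ acc) → ¬ Covered acc (b + count b acc)
Separated-∷⇒uncovered {acc} {b} sep (x , x≤end , end<x+c) with <-cmp x b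
... | tri< x<b x≢b _ = contradiction (≤-trans x-end≤b (m≤m+n b _)) (<⇒≱ end<x+c)
  where
  x-end≤b : x + count x acc ≤ b
  x-end≤b = subst (λ c → x + c ≤ b) (count-∷-≢ acc x≢b) (sep x<b (subst (0 <_) (sym (count-∷-≡ b acc)) z<s))
... | tri≈ _ refl _ = contradiction end<x+c (<-irrefl refl)
... | tri> _ x≢b b<x = contradiction (≤-trans b-end≤x x≤end) (<⇒≱ end<b-end)
  where
  end<b-end : b + count b acc < b + count b (b ∷ acc)
  end<b-end = subst (λ c → b + count b acc < b + c) (sym (count-∷-≡ b acc)) (+-monoʳ-< b ≤-refl)
  b-end≤x : b + count b (b ∷ acc) ≤ x
  b-end≤x = sep b<x (<-≤-trans (InBlock⇒count>0 {acc} (x≤end , end<x+c)) (count-mono (⊑-∷ b acc) x))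

Bounded-∷ : ∀ {m acc b} → Bounded m acc → 1 ≤ b → b + count b acc ≤ m → Bounded m (b ∷ acc)
Bounded-∷ {m} {acc} {b} bound 1≤b end≤m {x} x>0 with x ≟ b
... | yes refl rewrite count-∷-≡ x acc = 1≤b , subst (_≤ suc m) (sym (+-suc x _)) (s≤s end≤m)
... | no  x≢b rewrite count-∷-≢ acc x≢b = bound x>0

Bounded-∷⁻ : ∀ {m acc b} → Bounded m (b ∷ acc) → 1 ≤ b × b + count b acc ≤ m
Bounded-∷⁻ {m} {acc} {b} bound with bound {b} (subst (0 <_) (sym (count-∷-≡ b acc)) z<s)
... | 1≤b , end≤ rewrite count-∷-≡ b acc = 1≤b , s≤s⁻¹ (subst (_≤ suc m) (+-suc b _) end≤)

Bounded-rank : ∀ {m acc b} → Bounded m acc → 1 ≤ preference acc b → 1 ≤ b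
Bounded-rank {acc = acc} {b} bound 1≤pref with n≡0⊎n>0 (count b acc)
... | inj₁ b≡0 = subst (1 ≤_) (absent-preference {acc} b≡0) 1≤pref
... | inj₂ b>0 = proj₁ (bound b>0)

Tracks : List ℕ → List ℕ → Set
Tracks acc occ = ∀ s → T (elem s occ) ⇔ Covered acc s

Tracks-[] : Tracks [] []
Tracks-[] s = mk⇔ (λ ()) (λ c → contradiction c Covered-[])

Tracks-∷ : ∀ {acc occ b} → Tracks acc occ → Tracks (b ∷ acc) (b + count b acc ∷ occ)
Tracks-∷ {acc} {occ} tracks s = mk⇔
  (from (Covered-∷ {acc}) ∘ map₂ (to (tracks s)) ∘ to (elem-∷ {l = occ}))
  (from (elem-∷ {l = occ}) ∘ map₂ (from (tracks s)) ∘ to (Covered-∷ {acc}))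

data ParksAt (m : ℕ) (occ : List ℕ) (a : ℕ) : ℕ → Set where
  at-preference : ¬ T (elem a occ) → ParksAt m occ a a
  at-next       : T (elem a occ) → suc a ≤ m → ¬ T (elem (suc a) occ) → ParksAt m occ a (suc a)

parks-∷ : ∀ {m occ a as} → T (parks m occ (a ∷ as)) ⇔ (∃ λ s → ParksAt m occ a s × T (parks m (s ∷ occ) as))
parks-∷ {m} {occ} {a} {as} = mk⇔ park unpark
  where
  park : T (parks m occ (a ∷ as)) → ∃ λ s → ParksAt m occ a s × T (parks m (s ∷ occ) as)
  park t with elem a occ in a∈ | suc a ≤ᵇ m in a+1≤m | elem (suc a) occ in a+1∈
  ... | false | _     | _     = a , at-preference (subst T a∈) , t
  ... | true  | true  | false =
    suc a , at-next (subst T (sym a∈) _) (≤ᵇ⇒≤ _ m (subst T (sym a+1≤m) _)) (subst T a+1∈) , t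
  unpark : (∃ λ s → ParksAt m occ a s × T (parks m (s ∷ occ) as)) → T (parks m occ (a ∷ as))
  unpark (_ , at-preference a∉ , t) rewrite ¬T⇒≡false a∉ = t
  unpark (_ , at-next a∈ a+1≤m a+1∉ , t) rewrite to T-≡ a∈ | to T-≡ (≤⇒≤ᵇ a+1≤m) | ¬T⇒≡false a+1∉ = t

ParksAt-uncovered : ∀ {m acc occ a s} → Tracks acc occ → ParksAt m occ a s → ¬ Covered acc s
ParksAt-uncovered tracks (at-preference a∉) = a∉ ∘ from (tracks _)
ParksAt-uncovered tracks (at-next _ _ a+1∉) = a+1∉ ∘ from (tracks _)

ParksAt-≤ : ∀ {m occ a s} → ParksAt m occ a s → a ≤ m → s ≤ m
ParksAt-≤ (at-preference _)   a≤m = a≤m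
ParksAt-≤ (at-next _ a+1≤m _) _   = a+1≤m

ParksAt⇒rank : ∀ {m acc occ a s} → Tracks acc occ → ParksAt m occ a s →
               ∃ λ b → preference acc b ≡ a × b + count b acc ≡ s
ParksAt⇒rank {acc = acc} {a = a} tracks (at-preference a∉) =
  a , absent-preference {acc} a≡0 , absent-blockEnd {acc} a≡0
  where
  a≡0 = uncovered⇒count≡0 {acc} (a∉ ∘ from (tracks a))
ParksAt⇒rank {acc = acc} {a = a} tracks (at-next a∈ _ a+1∉) =
  x , suc-injective (trans (sym (preference-blockEnd {acc} (InBlock⇒count>0 {acc} x-block))) end≡a+1) ,
  end≡a+1
  where
  x = proj₁ (to (tracks a) a∈)
  x-block = proj₂ (to (tracks a) a∈)
  end≡a+1 : x + count x acc ≡ suc a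
  end≡a+1 = ≤-antisym (uncovered-blockEnd {acc} (a+1∉ ∘ from (tracks (suc a))) (m≤n⇒m≤1+n (proj₁ x-block)))
                      (proj₂ x-block)

ParksAt-preference : ∀ {m acc occ b} → Tracks acc occ →
                     ¬ Covered acc (b + count b acc) → b + count b acc ≤ m →
                     ParksAt m occ (preference acc b) (b + count b acc)
ParksAt-preference {m} {acc} {occ} {b} tracks free end≤m with n≡0⊎n>0 (count b acc)
... | inj₁ b≡0 =
  subst₂ (ParksAt m occ) (sym (absent-preference {acc} b≡0)) (sym (absent-blockEnd {acc} b≡0))
         (at-preference (subst (¬_ ∘ Covered acc) (absent-blockEnd {acc} b≡0) free ∘ to (tracks b)))
... | inj₂ b>0 rewrite preference-blockEnd {acc} b>0 =
  at-next (from (tracks _) (b , InBlock-preference {acc} b>0)) end≤m (free ∘ to (tracks _))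

rankOf : List ℕ → ℕ → ℕ
rankOf acc a with any? (λ x → preference acc x ≟ a) acc
... | yes found = proj₁ (find found)
... | no  _     = a

rankOf-uncovered : ∀ {acc a} → ¬ Covered acc a → rankOf acc a ≡ a
rankOf-uncovered {acc} {a} a-free with any? (λ x → preference acc x ≟ a) acc
... | no  _     = refl
... | yes found =
  let x , x∈acc , pref≡a = find found
  in contradiction (x , subst (InBlock acc x) pref≡a (InBlock-preference {acc} (∈⇒count>0 x∈acc))) a-free

rankOf-preference : ∀ {acc b} → Separated acc → ¬ Covered acc (b + count b acc) →
                    rankOf acc (preference acc b) ≡ b
rankOf-preference {acc} {b} sep free with n≡0⊎n>0 (count b acc)
... | inj₁ b≡0 =
  trans (cong (rankOf acc) (absent-preference {acc} b≡0))
        (rankOf-uncovered {acc} (subst (¬_ ∘ Covered acc) (absent-blockEnd {acc} b≡0) free))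
... | inj₂ b>0 with any? (λ x → preference acc x ≟ preference acc b) acc
...   | no  none  = contradiction (lose (count>0⇒∈ b>0) refl) none
...   | yes found =
  let x , x∈acc , pref≡ = find found
  in InBlock-unique {acc} sep (subst (InBlock acc x) pref≡ (InBlock-preference {acc} (∈⇒count>0 x∈acc)))
                              (InBlock-preference {acc} b>0)

-- The two maps

toPrefs : ∀ {k} → List ℕ → Vec ℕ k → Vec ℕ k
toPrefs acc []ᵥ       = []ᵥ
toPrefs acc (b ∷ᵥ bs) = preference acc b ∷ᵥ toPrefs (b ∷ acc) bs

toRanks : ∀ {k} → List ℕ → Vec ℕ k → Vec ℕ k
toRanks acc []ᵥ       = []ᵥ
toRanks acc (a ∷ᵥ as) = rankOf acc a ∷ᵥ toRanks (rankOf acc a ∷ acc) as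

module _ {m : ℕ} where

  toRanks-correct : ∀ {k} acc occ (α : Vec ℕ k) → Separated acc → Bounded m acc → Tracks acc occ →
                    T (inRange m (toList α)) → T (parks m occ (toList α)) →
                    toPrefs acc (toRanks acc α) ≡ α ×
                    Separated (acc ++ toList (toRanks acc α)) × Bounded m (acc ++ toList (toRanks acc α))
  toRanks-correct acc occ []ᵥ sep bound _ _ _ rewrite ++-identityʳ acc = refl , sep , bound
  toRanks-correct acc occ (a ∷ᵥ as) sep bound tracks inRange parked
    with to (parks-∷ {m} {occ} {a} {toList as}) parked | to (inRange⇔ {m} {a ∷ toList as}) inRange
  ... | s , parksAt , parked′ | entries
    with b , refl , refl ← ParksAt⇒rank {acc = acc} tracks parksAt
    rewrite rankOf-preference {acc} {b} sep (ParksAt-uncovered {acc = acc} tracks parksAt) =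
    let prefs≡ , sep′ , bound′ = toRanks-correct (b ∷ acc) (b + count b acc ∷ occ) as
          (Separated-∷ {acc} sep (ParksAt-uncovered {acc = acc} tracks parksAt))
          (Bounded-∷ {m} {acc} bound (Bounded-rank {m} {acc} bound 1≤a) (ParksAt-≤ parksAt a≤m))
          (Tracks-∷ {acc} {occ} tracks)
          (from (inRange⇔ {m} {toList as}) (entries ∘ there))
          parked′
        β′ = toList (toRanks (b ∷ acc) as)
    in cong (preference acc b ∷ᵥ_) prefs≡ ,
       Separated-⊑ (shift-⊑ acc b β′) sep′ ,
       Bounded-⊑ (shift-⊑ acc b β′) bound′
    where
    1≤a = proj₁ (entries (here refl))
    a≤m = proj₂ (entries (here refl))

  toPrefs-correct : ∀ {k} acc occ (β : Vec ℕ k) →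
                    Separated (acc ++ toList β) → Bounded m (acc ++ toList β) → Tracks acc occ →
                    toRanks acc (toPrefs acc β) ≡ β ×
                    T (inRange m (toList (toPrefs acc β))) × T (parks m occ (toList (toPrefs acc β)))
  toPrefs-correct acc occ []ᵥ _ _ _ = refl , _ , _
  toPrefs-correct acc occ (b ∷ᵥ bs) sep bound tracks
    with Separated-∷⇒uncovered {acc} {b} (Separated-⊑ (∷-⊑-shift acc b (toList bs)) sep)
       | Bounded-∷⁻ {m} {acc} (Bounded-⊑ (∷-⊑-shift acc b (toList bs)) bound)
  ... | free | 1≤b , end≤m
    rewrite rankOf-preference {acc} {b} (Separated-⊑ (⊑-++ acc (b ∷ toList bs)) sep) free =
    let ranks≡ , inRange′ , parked′ = toPrefs-correct (b ∷ acc) (b + count b acc ∷ occ) bs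
          (Separated-⊑ (unshift-⊑ acc b (toList bs)) sep)
          (Bounded-⊑ (unshift-⊑ acc b (toList bs)) bound)
          (Tracks-∷ {acc} {occ} tracks)
        α′ = toList (toPrefs (b ∷ acc) bs)
        head-inRange = ≤-trans 1≤b (m≤m+n b _) , ≤-trans (preference≤blockEnd {acc} {b}) end≤m
    in cong (b ∷ᵥ_) ranks≡ ,
       from (inRange⇔ {m} {preference acc b ∷ α′})
         (λ { (here refl) → head-inRange ; (there x∈) → to inRange⇔ inRange′ x∈ }) ,
       from (parks-∷ {m} {occ} {preference acc b} {α′})
         (_ , ParksAt-preference {m} {acc} tracks free end≤m , parked′)

Fresh : List ℕ → List ℕ → Set
Fresh acc l = ∀ {x} → x ∈ l → ¬ Covered acc x

Fresh-∷ : ∀ {acc b l} → T (distinct (b ∷ l)) → Fresh acc (b ∷ l) → Fresh (b ∷ acc) l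
Fresh-∷ {acc} {b} {l} d fresh {x} x∈l covered with to (Covered-∷ {acc}) covered
... | inj₂ c     = fresh (there x∈l) c
... | inj₁ x≡end = proj₁ (distinct-∷⁻ {b} {l} d) (∈⇒elem (subst (_∈ l) x≡b x∈l))
  where
  x≡b : x ≡ b
  x≡b = trans x≡end (absent-blockEnd {acc} (uncovered⇒count≡0 {acc} (fresh (here refl))))

toPrefs-take : ∀ {k} r {acc} (β : Vec ℕ k) →
               T (distinct (take r (toList β))) → Fresh acc (take r (toList β)) →
               take r (toList (toPrefs acc β)) ≡ take r (toList β)
toPrefs-take zero    _   _ _ = refl
toPrefs-take (suc r) []ᵥ _ _ = refl
toPrefs-take (suc r) {acc} (b ∷ᵥ bs) d fresh =
  cong₂ _∷_ (absent-preference {acc} (uncovered⇒count≡0 {acc} (fresh (here refl))))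
            (toPrefs-take r bs (proj₂ (distinct-∷⁻ {b} {take r (toList bs)} d)) (Fresh-∷ {acc} d fresh))

toRanks-take : ∀ {k} r {acc} (α : Vec ℕ k) →
               T (distinct (take r (toList α))) → Fresh acc (take r (toList α)) →
               take r (toList (toRanks acc α)) ≡ take r (toList α)
toRanks-take zero    _   _ _ = refl
toRanks-take (suc r) []ᵥ _ _ = refl
toRanks-take (suc r) {acc} (a ∷ᵥ as) d fresh rewrite rankOf-uncovered {acc} (fresh (here refl)) =
  cong (a ∷_) (toRanks-take r as (proj₂ (distinct-∷⁻ {a} {take r (toList as)} d)) (Fresh-∷ {acc} d fresh))

isFR⇒Separated×Bounded : ∀ {m} (β : Vec ℕ m) → T (isFR m β) → Separated (toList β) × Bounded m (toList β)
isFR⇒Separated×Bounded {m} β fr =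
  Ranking⇒Separated rank , subst (λ n → Bounded n (toList β)) (length-toList β) (Ranking⇒Bounded rank)
  where
  rank : Ranking (toList β)
  rank = isFubiniList⇒Ranking (proj₂ (to (T-∧ {inRange m (toList β)}) fr))

Separated×Bounded⇒isFR : ∀ {n} (β : Vec ℕ (suc n)) → Separated (toList β) → Bounded (suc n) (toList β) →
                         T (isFR (suc n) β)
Separated×Bounded⇒isFR {n} β@(_ ∷ᵥ _) sep bound =
  from T-∧ (from inRange⇔ (Bounded-entry {suc n} {toList β} bound) ,
            Ranking⇒isFubiniList (Separated×Bounded⇒Ranking {toList β} sep bound′))
  where
  bound′ : Bounded (length (toList β)) (toList β)
  bound′ = subst (λ n → Bounded n (toList β)) (sym (length-toList β)) bound

subtype-≡ : ∀ {A : Set} {P : A → Bool} {u v : Σ A (T ∘ P)} → proj₁ u ≡ proj₁ v → u ≡ v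
subtype-≡ {u = _ , p} {_ , q} refl = cong (_ ,_) (T-irrelevant p q)

-- Length zero is excluded: the empty tuple is a unit interval parking function, but no
-- Fubini ranking is empty (its minimum must be 1).
UPF⤖FR : ∀ n r → UPF (suc n) r ⤖ FR (suc n) r
UPF⤖FR n r = ↔⇒⤖ (mk↔ₛ′ toFR toUPF (λ (β , q) → subtype-≡ {P = isFRr m r} (proj₁ (ranks∘prefs β q)))
                                     (λ (α , p) → subtype-≡ {P = isUPFr m r} (proj₁ (prefs∘ranks α p))))
  where
  m = suc n
  prefs∘ranks : ∀ α → T (isUPFr m r α) →
                toPrefs [] (toRanks [] α) ≡ α ×
                Separated (toList (toRanks [] α)) × Bounded m (toList (toRanks [] α))
  prefs∘ranks α p =
    let inR , parked = to (T-∧ {inRange m (toList α)}) (proj₁ (to (T-∧ {isUPF m α}) p))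
    in toRanks-correct [] [] α (λ _ ()) (λ ()) Tracks-[] inR parked
  ranks∘prefs : ∀ β → T (isFRr m r β) →
                toRanks [] (toPrefs [] β) ≡ β ×
                T (inRange m (toList (toPrefs [] β))) × T (parks m [] (toList (toPrefs [] β)))
  ranks∘prefs β q =
    let sep , bound = isFR⇒Separated×Bounded β (proj₁ (to (T-∧ {isFR m β}) q))
    in toPrefs-correct [] [] β sep bound Tracks-[]
  toFR : UPF m r → FR m r
  toFR (α , p) =
    let _ , sep , bound = prefs∘ranks α p
        dist = proj₂ (to (T-∧ {isUPF m α}) p)
    in toRanks [] α , from T-∧ (Separated×Bounded⇒isFR (toRanks [] α) sep bound ,
                                subst (T ∘ distinct) (sym (toRanks-take r α dist (λ _ → Covered-[]))) dist)
  toUPF : FR m r → UPF m r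
  toUPF (β , q) =
    let _ , inR , parked = ranks∘prefs β q
        dist = proj₂ (to (T-∧ {isFR m β}) q)
    in toPrefs [] β , from T-∧ (from T-∧ (inR , parked) ,
                                subst (T ∘ distinct) (sym (toPrefs-take r β dist (λ _ → Covered-[]))) dist)

theorem3p5 : (r n : ℕ) → 1 ≤ r → UPF (n + r) r ⤖ FR (n + r) r
theorem3p5 zero    n ()
theorem3p5 (suc r) n _ rewrite +-suc n r = UPF⤖FR (n + r) (suc r)
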